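{- For every integer $\ell \geq 2$, let $G_\ell$ be the graph with vertex set $\{0,1\}^{2\ell+1}$ in which two vertices are adjacent iff the corresponding binary strings differ in exactly $\ell$ or exactly $\ell+1$ positions. Then $\omega(G_\ell) \leq 2\ell+2$.
   Context: $\omega(G)$ denotes the clique number of $G$. -}

module Defs where

open import Data.Nat using (ℕ; zero; suc; _+_; _*_)
open import Data.Bool using (Bool; true; false; _xor_)
open import Data.Vec using (Vec; []; _∷_)
open import Data.List using (List)
open import Data.List.Membership.Propositional using (_∈_)
open import Data.List.Relation.Unary.Unique.Propositional using (Unique)
open import Relation.Binary.PropositionalEquality using (_≡_)
open import Data.Sum using (_⊎_)
open import Data.Product using (_×_)
open import Relation.Nullary using (¬_)

hamming : ∀ {n} → Vec Bool n → Vec Bool n → ℕ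
hamming [] [] = 0
hamming (x ∷ xs) (y ∷ ys) with x xor y
... | true  = suc (hamming xs ys)
... | false = hamming xs ys

Vertex : ℕ → Set
Vertex ℓ = Vec Bool (suc (2 * ℓ))

Adj : (ℓ : ℕ) → Vertex ℓ → Vertex ℓ → Set
Adj ℓ u v = (hamming u v ≡ ℓ) ⊎ (hamming u v ≡ suc ℓ)

IsClique : (ℓ : ℕ) → List (Vertex ℓ) → Set
IsClique ℓ K = Unique K × (∀ u v → u ∈ K → v ∈ K → ¬ (u ≡ v) → Adj ℓ u v)

module Submission where

-- Replace each vertex x by the word of even weight among x and its complement x̄.
-- Complementing one endpoint turns the distance h into 2ℓ + 1 − h, which swaps ℓ and ℓ + 1,
-- so adjacency survives; two even-weight words are at even distance.  Hence the normalised
-- vertices of a clique are pairwise at distance E, the even one of ℓ and ℓ + 1: they form an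
-- equidistant binary code.  Mapping a word x to (1, ±1, …, ±1) ∈ ℤ^{2ℓ+2} gives vectors whose
-- Gram matrix is P·J + Q·I with Q = 2E > 0 and P = 2ℓ + 2 − 2E ≥ 0, which forces them to be
-- linearly independent, so there are at most 2ℓ + 2 of them.

open import Defs
open import Data.Bool using (Bool; true; false)
open import Data.Vec using (Vec; []; _∷_; lookup)

open import Data.Fin using (Fin; zero; suc; punchIn)
open import Data.Fin.Properties using (all?; ¬∀⟶∃¬; punchInᵢ≢i)
open import Data.Vec.Functional using (Vector; tail; insertAt; removeAt)
open import Data.Vec.Functional.Properties using (insertAt-lookup; insertAt-punchIn)
open import Data.Product using (_,_)
open import Data.Sum using (_⊎_; inj₁; inj₂)
open import Function using (_∘_)
open import Relation.Nullary using (yes; no; contradiction)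
open import Relation.Binary.PropositionalEquality using (_≡_; _≢_; refl; sym; trans; cong; cong₂; subst; module ≡-Reasoning)

module IntegerLinearAlgebra where

  open import Data.Nat as ℕ using (ℕ; zero; suc; _≤_; z≤n; s≤s)
  open import Data.Nat.Properties using (m≤n⇒m≤1+n; m+n≡0⇒m≡0)
  open import Data.Integer using (ℤ; +_; 0ℤ; 1ℤ; _+_; _*_; -_; _-_; _≟_)
  open import Data.Integer.Properties
    using (+-*-semiring; +-identityʳ; *-zeroʳ; *-assoc; i*j≡0⇒i≡0∨j≡0; +-injective; pos-+; pos-*)
  open import Data.Integer.Tactic.RingSolver using (solve-∀)
  open import Algebra.Properties.Semiring.Sum +-*-semiring
    using (sum; sum-syntax; sum-cong-≗; sum-remove; sum-replicate-zero; ∑-comm; ∑-distrib-+; *-distribˡ-sum; *-distribʳ-sum)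
  open ≡-Reasoning

  nonzero-factor : ∀ {a b} → a ≢ 0ℤ → a * b ≡ 0ℤ → b ≡ 0ℤ
  nonzero-factor {a} a≢0 ab≡0 with i*j≡0⇒i≡0∨j≡0 a ab≡0
  ... | inj₁ a≡0 = contradiction a≡0 a≢0
  ... | inj₂ b≡0 = b≡0

  ∑-const : ∀ m x → ∑[ j < m ] x ≡ + m * x
  ∑-const zero    x = refl
  ∑-const (suc m) x = trans (cong (_+_ x) (∑-const m x)) (step x (+ m))
    where
    step : ∀ x m → x + m * x ≡ (1ℤ + m) * x
    step = solve-∀

  combination : ∀ {m n} → Vector ℤ m → (Fin m → Vector ℤ n) → Vector ℤ n
  combination {m} c v k = ∑[ i < m ] (c i * v i k)

  LinearlyIndependent : ∀ {m n} → (Fin m → Vector ℤ n) → Set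
  LinearlyIndependent v = ∀ c → (∀ k → combination c v k ≡ 0ℤ) → ∀ i → c i ≡ 0ℤ

  combination-scale : ∀ {m n} a (c : Vector ℤ m) (v : Fin m → Vector ℤ n) k →
                      combination (λ i → a * c i) v k ≡ a * combination c v k
  combination-scale a c v k = trans (sum-cong-≗ (λ i → *-assoc a (c i) (v i k))) (sym (*-distribˡ-sum a (λ i → c i * v i k)))

  combination-insertAt : ∀ {m n} (c : Vector ℤ m) p x (v : Fin (suc m) → Vector ℤ n) k →
    combination (insertAt c p x) v k ≡ x * v p k + combination c (removeAt v p) k
  combination-insertAt c p x v k = trans (sum-remove {i = p} (λ i → insertAt c p x i * v i k))
    (cong₂ _+_ (cong (_* v p k) (insertAt-lookup c p x))
               (sum-cong-≗ (λ j → cong (_* v (punchIn p j) k) (insertAt-punchIn c p x j))))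

  ∑-linear : ∀ {m} a b (x y : Vector ℤ m) → ∑[ j < m ] (a * x j + y j * b) ≡ a * sum x + sum y * b
  ∑-linear a b x y = trans (∑-distrib-+ (λ j → a * x j) (λ j → y j * b))
    (sym (cong₂ _+_ (*-distribˡ-sum a x) (*-distribʳ-sum b y)))

  -- Removing the pivot vector vₚ (whose first coordinate a is nonzero) and clearing the
  -- first coordinate of every other vector with it: u ↦ a·u − u₀·vₚ, first coordinate dropped.
  eliminate : ∀ {m n} → (Fin (suc m) → Vector ℤ (suc n)) → Fin (suc m) → Fin m → Vector ℤ n
  eliminate v p j k = v p zero * u (suc k) - u zero * v p (suc k)
    where u = v (punchIn p j)

  combination-eliminate : ∀ {m n} (c : Vector ℤ m) (v : Fin (suc m) → Vector ℤ (suc n)) p k →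
    combination c (eliminate v p) k
      ≡ v p zero * combination c (removeAt v p) (suc k) - combination c (removeAt v p) zero * v p (suc k)
  combination-eliminate {m} c v p k = begin
    ∑[ j < m ] (c j * (a * u j (suc k) - u j zero * b))
      ≡⟨ sum-cong-≗ (λ j → regroup (c j) a (u j (suc k)) (u j zero) b) ⟩
    ∑[ j < m ] (a * (c j * u j (suc k)) + (c j * u j zero) * - b)
      ≡⟨ ∑-linear a (- b) (λ j → c j * u j (suc k)) (λ j → c j * u j zero) ⟩
    a * combination c u (suc k) + combination c u zero * - b
      ≡⟨ regroup′ a (combination c u (suc k)) (combination c u zero) b ⟩
    a * combination c u (suc k) - combination c u zero * b
      ∎
    where
    a = v p zero
    b = v p (suc k)
    u = removeAt v p
    regroup : ∀ c a x y b → c * (a * x - y * b) ≡ a * (c * x) + (c * y) * - b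
    regroup = solve-∀
    regroup′ : ∀ a x y b → a * x + y * - b ≡ a * x - y * b
    regroup′ = solve-∀

  -- Elimination preserves linear independence: a vanishing combination of the eliminated
  -- family lifts to one of the original family with coefficients a·cⱼ.
  eliminate-independent : ∀ {m n} (v : Fin (suc m) → Vector ℤ (suc n)) p →
    v p zero ≢ 0ℤ → LinearlyIndependent v → LinearlyIndependent (eliminate v p)
  eliminate-independent v p a≢0 independent c vanishes j =
    nonzero-factor a≢0 (trans (sym (insertAt-punchIn d′ p (- D) j)) (independent d d-vanishes (punchIn p j)))
    where
    a = v p zero
    u = removeAt v p
    D = combination c u zero
    d′ = λ j → a * c j
    d = insertAt d′ p (- D)
    cleared : ∀ k → - D * v p k + a * combination c u k ≡ 0ℤ
    cleared zero    = cancels D a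
      where
      cancels : ∀ D a → - D * a + a * D ≡ 0ℤ
      cancels = solve-∀
    cleared (suc k) = trans (reorder D (v p (suc k)) a _) (trans (sym (combination-eliminate c v p k)) (vanishes k))
      where
      reorder : ∀ D b a X → - D * b + a * X ≡ a * X - D * b
      reorder = solve-∀
    d-vanishes : ∀ k → combination d v k ≡ 0ℤ
    d-vanishes k = trans (combination-insertAt d′ p (- D) v k)
                         (trans (cong (_+_ (- D * v p k)) (combination-scale a c u k)) (cleared k))

  drop-zero-coordinate : ∀ {m n} (v : Fin m → Vector ℤ (suc n)) → (∀ i → v i zero ≡ 0ℤ) →
    LinearlyIndependent v → LinearlyIndependent (tail ∘ v)
  drop-zero-coordinate {m} v zero-coordinate independent c vanishes = independent c vanishes′
    where
    vanishes′ : ∀ k → combination c v k ≡ 0ℤ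
    vanishes′ zero    = trans (sum-cong-≗ (λ i → trans (cong (c i *_) (zero-coordinate i)) (*-zeroʳ (c i))))
                              (sum-replicate-zero m)
    vanishes′ (suc k) = vanishes k

  -- By induction
  -- on n: either the first coordinate vanishes everywhere and is dropped, or a pivot
  -- eliminates it at the cost of one vector.
  dimension-bound : ∀ n {m} (v : Fin m → Vector ℤ n) → LinearlyIndependent v → m ≤ n
  dimension-bound n       {zero}  v independent = z≤n
  dimension-bound zero    {suc m} v independent = contradiction (independent (λ _ → 1ℤ) (λ ()) zero) λ ()
  dimension-bound (suc n) {suc m} v independent with all? (λ i → v i zero ≟ 0ℤ)
  ... | yes zero-coordinate =
    m≤n⇒m≤1+n (dimension-bound n (tail ∘ v) (drop-zero-coordinate v zero-coordinate independent))
  ... | no ¬zero-coordinate with ¬∀⟶∃¬ _ _ (λ i → v i zero ≟ 0ℤ) ¬zero-coordinate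
  ...   | p , pivot≢0 = s≤s (dimension-bound n (eliminate v p) (eliminate-independent v p pivot≢0 independent))

  inner : ∀ {n} → Vector ℤ n → Vector ℤ n → ℤ
  inner {n} u w = ∑[ k < n ] (u k * w k)

  combination-inner : ∀ {m n} (c : Vector ℤ m) (v : Fin m → Vector ℤ n) w →
    ∑[ i < m ] (c i * inner (v i) w) ≡ inner (combination c v) w
  combination-inner {m} {n} c v w = begin
    ∑[ i < m ] (c i * ∑[ k < n ] (v i k * w k))
      ≡⟨ sum-cong-≗ (λ i → *-distribˡ-sum (c i) (λ k → v i k * w k)) ⟩
    ∑[ i < m ] ∑[ k < n ] (c i * (v i k * w k))
      ≡⟨ ∑-comm (λ i k → c i * (v i k * w k)) ⟩
    ∑[ k < n ] ∑[ i < m ] (c i * (v i k * w k))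
      ≡⟨ sum-cong-≗ (λ k → sum-cong-≗ (λ i → sym (*-assoc (c i) (v i k) (w k)))) ⟩
    ∑[ k < n ] ∑[ i < m ] (c i * v i k * w k)
      ≡⟨ sum-cong-≗ (λ k → sym (*-distribʳ-sum (w k) (λ i → c i * v i k))) ⟩
    ∑[ k < n ] (combination c v k * w k)
      ∎

  uniform-row : ∀ {m} (G : Fin m → Fin m → ℤ) p q →
    (∀ i → G i i ≡ p + q) → (∀ i j → i ≢ j → G i j ≡ p) → ∀ c j → ∑[ i < m ] (c i * G i j) ≡ q * c j + p * sum c
  uniform-row {suc m} G p q diagonal off-diagonal c j = begin
    ∑[ i < suc m ] (c i * G i j)
      ≡⟨ sum-remove {i = j} (λ i → c i * G i j) ⟩
    c j * G j j + ∑[ i < m ] (c (punchIn j i) * G (punchIn j i) j)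
      ≡⟨ cong₂ _+_ (cong (c j *_) (diagonal j))
                   (sum-cong-≗ (λ i → cong (c (punchIn j i) *_) (off-diagonal _ j (punchInᵢ≢i j i)))) ⟩
    c j * (p + q) + ∑[ i < m ] (c (punchIn j i) * p)
      ≡⟨ cong (_+_ (c j * (p + q))) (sym (*-distribʳ-sum p (removeAt c j))) ⟩
    c j * (p + q) + sum (removeAt c j) * p
      ≡⟨ regroup (c j) p q (sum (removeAt c j)) ⟩
    q * c j + p * (c j + sum (removeAt c j))
      ≡⟨ cong (λ s → q * c j + p * s) (sym (sum-remove {i = j} c)) ⟩
    q * c j + p * sum c
      ∎
    where
    regroup : ∀ x p q r → x * (p + q) + r * p ≡ q * x + p * (x + r)
    regroup = solve-∀

  -- For naturals P and Q > 0, the system Q·cⱼ + P·∑c = 0 (all j) has only the trivial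
  -- solution: summing over j gives (Q + m P)·∑c = 0, so ∑c = 0 and then each cⱼ = 0.
  uniform-system-trivial : ∀ {m} (P Q : ℕ) → Q ≢ 0 → (c : Vector ℤ m) →
    (∀ j → + Q * c j + + P * sum c ≡ 0ℤ) → ∀ j → c j ≡ 0ℤ
  uniform-system-trivial {m} P Q Q≢0 c equations j =
    nonzero-factor (Q≢0 ∘ +-injective) (begin
      + Q * c j                ≡⟨ sym (+-identityʳ (+ Q * c j)) ⟩
      + Q * c j + 0ℤ           ≡⟨ cong (_+_ (+ Q * c j)) (sym P-term) ⟩
      + Q * c j + + P * sum c  ≡⟨ equations j ⟩
      0ℤ                       ∎)
    where
    S = sum c
    total : (+ Q + + m * + P) * S ≡ 0ℤ
    total = begin
      (+ Q + + m * + P) * S                 ≡⟨ regroup (+ Q) (+ m) (+ P) S ⟩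
      + Q * S + + m * (+ P * S)             ≡⟨ cong₂ _+_ (*-distribˡ-sum (+ Q) c) (sym (∑-const m (+ P * S))) ⟩
      ∑[ j < m ] (+ Q * c j) + ∑[ j < m ] (+ P * S) ≡⟨ sym (∑-distrib-+ (λ j → + Q * c j) (λ _ → + P * S)) ⟩
      ∑[ j < m ] (+ Q * c j + + P * S)      ≡⟨ sum-cong-≗ equations ⟩
      ∑[ j < m ] 0ℤ                         ≡⟨ sum-replicate-zero m ⟩
      0ℤ                                    ∎
      where
      regroup : ∀ q m p s → (q + m * p) * s ≡ q * s + m * (p * s)
      regroup = solve-∀
    Q+mP≢0 : + Q + + m * + P ≢ 0ℤ
    Q+mP≢0 eq = Q≢0 (m+n≡0⇒m≡0 Q (+-injective (trans (trans (pos-+ Q (m ℕ.* P)) (cong (_+_ (+ Q)) (pos-* m P))) eq)))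
    P-term : + P * S ≡ 0ℤ
    P-term = trans (cong (+ P *_) (nonzero-factor Q+mP≢0 total)) (*-zeroʳ (+ P))

  uniform-gram-independent : ∀ {m n} (P Q : ℕ) → Q ≢ 0 → (v : Fin m → Vector ℤ n) →
    (∀ i → inner (v i) (v i) ≡ + P + + Q) → (∀ i j → i ≢ j → inner (v i) (v j) ≡ + P) →
    LinearlyIndependent v
  uniform-gram-independent {m} {n} P Q Q≢0 v diagonal off-diagonal c vanishes =
    uniform-system-trivial P Q Q≢0 c λ j → begin
      + Q * c j + + P * sum c
        ≡⟨ sym (uniform-row (λ i j → inner (v i) (v j)) (+ P) (+ Q) diagonal off-diagonal c j) ⟩
      ∑[ i < m ] (c i * inner (v i) (v j))    ≡⟨ combination-inner c v (v j) ⟩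
      inner (combination c v) (v j)          ≡⟨ sum-cong-≗ (λ k → cong (_* v j k) (vanishes k)) ⟩
      ∑[ k < n ] 0ℤ                          ≡⟨ sum-replicate-zero n ⟩
      0ℤ                                     ∎

module EquidistantCodes where

  open IntegerLinearAlgebra
  open import Data.Nat as ℕ using (suc; _≤_; _∸_)
  open import Data.Nat.Properties using (m∸n+n≡m; m+n≡0⇒m≡0)
  open import Data.Integer using (ℤ; +_; 1ℤ; -1ℤ; _+_; _*_)
  open import Data.Integer.Properties using (+-identityʳ; pos-+; +-*-semiring; +-0-abelianGroup)
  open import Data.Integer.Tactic.RingSolver using (solve-∀)
  open import Algebra.Properties.AbelianGroup +-0-abelianGroup using (∙-cancelʳ)
  open import Algebra.Properties.Semiring.Sum +-*-semiring using (sum-syntax)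
  open ≡-Reasoning

  sign : Bool → ℤ
  sign false = 1ℤ
  sign true  = -1ℤ

  -- Appending an agreeing (+1) or a disagreeing (−1, one more unit of distance) coordinate
  -- keeps the identity of sign-inner-hamming below.
  agree : ∀ {n} s h → s + (h + h) ≡ + n → 1ℤ + s + (h + h) ≡ + suc n
  agree s h eq = trans (regroup s h) (cong (_+_ 1ℤ) eq)
    where
    regroup : ∀ s h → 1ℤ + s + (h + h) ≡ 1ℤ + (s + (h + h))
    regroup = solve-∀

  disagree : ∀ {n} s h → s + (h + h) ≡ + n → -1ℤ + s + ((1ℤ + h) + (1ℤ + h)) ≡ + suc n
  disagree s h eq = trans (regroup s h) (cong (_+_ 1ℤ) eq)
    where
    regroup : ∀ s h → -1ℤ + s + ((1ℤ + h) + (1ℤ + h)) ≡ 1ℤ + (s + (h + h))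
    regroup = solve-∀

  sign-inner : ∀ {n} → Vec Bool n → Vec Bool n → ℤ
  sign-inner {n} x y = ∑[ k < n ] (sign (lookup x k) * sign (lookup y k))

  sign-inner-hamming : ∀ {n} (x y : Vec Bool n) → sign-inner x y + (+ hamming x y + + hamming x y) ≡ + n
  sign-inner-hamming []          []          = refl
  sign-inner-hamming (true ∷ x)  (true ∷ y)  = agree (sign-inner x y) (+ hamming x y) (sign-inner-hamming x y)
  sign-inner-hamming (false ∷ x) (false ∷ y) = agree (sign-inner x y) (+ hamming x y) (sign-inner-hamming x y)
  sign-inner-hamming (true ∷ x)  (false ∷ y) = disagree (sign-inner x y) (+ hamming x y) (sign-inner-hamming x y)
  sign-inner-hamming (false ∷ x) (true ∷ y)  = disagree (sign-inner x y) (+ hamming x y) (sign-inner-hamming x y)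

  hamming-self : ∀ {n} (x : Vec Bool n) → hamming x x ≡ 0
  hamming-self []          = refl
  hamming-self (true ∷ x)  = hamming-self x
  hamming-self (false ∷ x) = hamming-self x

  embed : ∀ {n} → Vec Bool n → Vector ℤ (suc n)
  embed x zero    = 1ℤ
  embed x (suc k) = sign (lookup x k)

  inner-embed : ∀ {n} (x y : Vec Bool n) {d} → hamming x y ≡ d →
    inner (embed x) (embed y) + (+ d + + d) ≡ + suc n
  inner-embed x y refl = agree (sign-inner x y) (+ hamming x y) (sign-inner-hamming x y)

  -- An equidistant binary code of length n with distance E, 0 < 2E ≤ n + 1, has at most n + 1
  -- words: the embedded words have Gram matrix (n + 1 − 2E)·J + 2E·I, so they are linearly
  -- independent in ℤⁿ⁺¹.
  equidistant-code-bound : ∀ {m n} E → E ≢ 0 → E ℕ.+ E ≤ suc n → (x : Fin m → Vec Bool n) →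
    (∀ i j → i ≢ j → hamming (x i) (x j) ≡ E) → m ≤ suc n
  equidistant-code-bound {m} {n} E E≢0 2E≤n+1 x equidistant =
    dimension-bound (suc n) (embed ∘ x) (uniform-gram-independent P Q Q≢0 (embed ∘ x) diagonal off-diagonal)
    where
    Q = E ℕ.+ E
    P = suc n ∸ Q
    Q≢0 : Q ≢ 0
    Q≢0 = E≢0 ∘ m+n≡0⇒m≡0 E
    P+Q : + P + + Q ≡ + suc n
    P+Q = trans (sym (pos-+ P Q)) (cong +_ (m∸n+n≡m 2E≤n+1))
    diagonal : ∀ i → inner (embed (x i)) (embed (x i)) ≡ + P + + Q
    diagonal i = trans (sym (+-identityʳ _)) (trans (inner-embed (x i) (x i) (hamming-self (x i))) (sym P+Q))
    off-diagonal : ∀ i j → i ≢ j → inner (embed (x i)) (embed (x j)) ≡ + P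
    off-diagonal i j i≢j = ∙-cancelʳ (+ Q) _ _ (begin
      inner (embed (x i)) (embed (x j)) + + Q          ≡⟨ cong (_+_ (inner (embed (x i)) (embed (x j)))) (pos-+ E E) ⟩
      inner (embed (x i)) (embed (x j)) + (+ E + + E)  ≡⟨ inner-embed (x i) (x j) (equidistant i j i≢j) ⟩
      + suc n                                          ≡⟨ sym P+Q ⟩
      + P + + Q                                        ∎)

open EquidistantCodes using (equidistant-code-bound)

-- Natural-number arithmetic is opened only from here on, so that the integer operators of the
-- two modules above are unambiguous.
open import Data.Nat using (ℕ; _≤_; _+_; _*_; suc)
open import Data.List using (List; length)
open import Data.Nat using (zero; z≤n; s≤s)
open import Data.Nat.Properties using (+-suc; +-identityʳ; +-comm; +-cancelʳ-≡; +-mono-≤; ≤-refl; ≤-trans; ≤-reflexive; n≤1+n)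
open import Data.Bool using (not; _xor_; if_then_else_)
open import Data.Bool.Properties using (not-involutive; not-distribˡ-xor; not-distribʳ-xor; xor-annihilates-not)
open import Data.Vec using (map)
import Data.List as List
open import Data.List.Membership.Propositional.Properties using (∈-lookup)
import Data.List.Relation.Unary.All as All
open import Data.List.Relation.Unary.AllPairs using (_∷_)
open import Data.List.Relation.Unary.Unique.Propositional using (Unique)

odd : ℕ → Bool
odd zero    = false
odd (suc n) = not (odd n)

double : ∀ ℓ → 2 * ℓ ≡ ℓ + ℓ
double ℓ = cong (ℓ +_) (+-identityʳ ℓ)

odd-2ℓ+1 : ∀ ℓ → odd (suc (2 * ℓ)) ≡ true
odd-2ℓ+1 ℓ = cong not (trans (cong odd (double ℓ)) (even-sum ℓ))
  where
  even-sum : ∀ ℓ → odd (ℓ + ℓ) ≡ false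
  even-sum zero    = refl
  even-sum (suc ℓ) = trans (cong (not ∘ odd) (+-suc ℓ ℓ)) (trans (not-involutive _) (even-sum ℓ))

parity : ∀ {n} → Vec Bool n → Bool
parity []      = false
parity (b ∷ x) = b xor parity x

odd-hamming : ∀ {n} (x y : Vec Bool n) → odd (hamming x y) ≡ parity x xor parity y
odd-hamming []          []          = refl
odd-hamming (true ∷ x)  (true ∷ y)  = trans (odd-hamming x y) (sym (xor-annihilates-not (parity x) (parity y)))
odd-hamming (true ∷ x)  (false ∷ y) = trans (cong not (odd-hamming x y)) (not-distribˡ-xor (parity x) (parity y))
odd-hamming (false ∷ x) (true ∷ y)  = trans (cong not (odd-hamming x y)) (not-distribʳ-xor (parity x) (parity y))
odd-hamming (false ∷ x) (false ∷ y) = odd-hamming x y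

complement : ∀ {n} → Vec Bool n → Vec Bool n
complement = map not

parity-complement : ∀ {n} (x : Vec Bool n) → parity (complement x) ≡ odd n xor parity x
parity-complement         []          = refl
parity-complement {suc n} (true ∷ x)  = trans (parity-complement x) (sym (xor-annihilates-not (odd n) (parity x)))
parity-complement {suc n} (false ∷ x) = trans (cong not (parity-complement x)) (not-distribˡ-xor (odd n) (parity x))

hamming-complementˡ : ∀ {n} (x y : Vec Bool n) → hamming (complement x) y + hamming x y ≡ n
hamming-complementˡ []          []          = refl
hamming-complementˡ (true ∷ x)  (true ∷ y)  = cong suc (hamming-complementˡ x y)
hamming-complementˡ (true ∷ x)  (false ∷ y) = trans (+-suc _ _) (cong suc (hamming-complementˡ x y))
hamming-complementˡ (false ∷ x) (true ∷ y)  = trans (+-suc _ _) (cong suc (hamming-complementˡ x y))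
hamming-complementˡ (false ∷ x) (false ∷ y) = cong suc (hamming-complementˡ x y)

hamming-complementʳ : ∀ {n} (x y : Vec Bool n) → hamming x (complement y) + hamming x y ≡ n
hamming-complementʳ []          []          = refl
hamming-complementʳ (true ∷ x)  (true ∷ y)  = cong suc (hamming-complementʳ x y)
hamming-complementʳ (true ∷ x)  (false ∷ y) = trans (+-suc _ _) (cong suc (hamming-complementʳ x y))
hamming-complementʳ (false ∷ x) (true ∷ y)  = trans (+-suc _ _) (cong suc (hamming-complementʳ x y))
hamming-complementʳ (false ∷ x) (false ∷ y) = cong suc (hamming-complementʳ x y)

complement-distance : ∀ ℓ {h h′} → h′ + h ≡ suc (2 * ℓ) →
  (h ≡ ℓ) ⊎ (h ≡ suc ℓ) → (h′ ≡ ℓ) ⊎ (h′ ≡ suc ℓ)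
complement-distance ℓ {h′ = h′} eq (inj₁ refl) =
  inj₂ (+-cancelʳ-≡ ℓ h′ (suc ℓ) (trans eq (cong suc (double ℓ))))
complement-distance ℓ {h′ = h′} eq (inj₂ refl) =
  inj₁ (+-cancelʳ-≡ (suc ℓ) h′ ℓ (trans eq (trans (cong suc (double ℓ)) (sym (+-suc ℓ ℓ)))))

Adj-complementˡ : ∀ {ℓ} (x y : Vertex ℓ) → Adj ℓ x y → Adj ℓ (complement x) y
Adj-complementˡ {ℓ} x y = complement-distance ℓ (hamming-complementˡ x y)

Adj-complementʳ : ∀ {ℓ} (x y : Vertex ℓ) → Adj ℓ x y → Adj ℓ x (complement y)
Adj-complementʳ {ℓ} x y = complement-distance ℓ (hamming-complementʳ x y)

complementIf : ∀ {n} → Bool → Vec Bool n → Vec Bool n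
complementIf true  x = complement x
complementIf false x = x

-- The representative of even weight among a word and its complement (when n is odd).
normalise : ∀ {n} → Vec Bool n → Vec Bool n
normalise x = complementIf (parity x) x

Adj-complementIf : ∀ {ℓ} (x y : Vertex ℓ) b b′ → Adj ℓ x y → Adj ℓ (complementIf b x) (complementIf b′ y)
Adj-complementIf x y false false adjacent = adjacent
Adj-complementIf x y true  false adjacent = Adj-complementˡ x y adjacent
Adj-complementIf x y false true  adjacent = Adj-complementʳ x y adjacent
Adj-complementIf x y true  true  adjacent = Adj-complementˡ x (complement y) (Adj-complementʳ x y adjacent)

Adj-normalise : ∀ {ℓ} (x y : Vertex ℓ) → Adj ℓ x y → Adj ℓ (normalise x) (normalise y)
Adj-normalise x y = Adj-complementIf x y (parity x) (parity y)

-- Normalised vertices have even weight, because the length 2ℓ + 1 is odd.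
parity-normalise : ∀ ℓ (x : Vertex ℓ) → parity (normalise x) ≡ false
parity-normalise ℓ x with parity x in odd-weight
... | false = odd-weight
... | true  = trans (parity-complement x) (cong₂ _xor_ (odd-2ℓ+1 ℓ) odd-weight)

evenNeighbour : ℕ → ℕ
evenNeighbour ℓ = if odd ℓ then suc ℓ else ℓ

even-choice : ∀ ℓ {h} → odd h ≡ false → (h ≡ ℓ) ⊎ (h ≡ suc ℓ) → h ≡ evenNeighbour ℓ
even-choice ℓ h-even (inj₁ refl) with odd ℓ
... | false = refl
... | true  = contradiction h-even λ ()
even-choice ℓ h-even (inj₂ refl) with odd ℓ
... | true  = refl
... | false = contradiction h-even λ ()

ℓ≤evenNeighbour : ∀ ℓ → ℓ ≤ evenNeighbour ℓ
ℓ≤evenNeighbour ℓ with odd ℓ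
... | true  = n≤1+n ℓ
... | false = ≤-refl

evenNeighbour≤1+ℓ : ∀ ℓ → evenNeighbour ℓ ≤ suc ℓ
evenNeighbour≤1+ℓ ℓ with odd ℓ
... | true  = ≤-refl
... | false = n≤1+n ℓ

evenNeighbour≢0 : ∀ ℓ → 1 ≤ ℓ → evenNeighbour ℓ ≢ 0
evenNeighbour≢0 ℓ 1≤ℓ E≡0 = contradiction (≤-trans 1≤ℓ (≤-trans (ℓ≤evenNeighbour ℓ) (≤-reflexive E≡0))) λ ()

evenNeighbour-doubled : ∀ ℓ → evenNeighbour ℓ + evenNeighbour ℓ ≤ suc (suc (2 * ℓ))
evenNeighbour-doubled ℓ = ≤-trans (+-mono-≤ (evenNeighbour≤1+ℓ ℓ) (evenNeighbour≤1+ℓ ℓ))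
  (≤-reflexive (cong suc (trans (+-suc ℓ ℓ) (cong suc (sym (double ℓ))))))

lookup-injective : ∀ {A : Set} {xs : List A} → Unique xs → ∀ i j → List.lookup xs i ≡ List.lookup xs j → i ≡ j
lookup-injective (_    ∷ _)      zero    zero    _  = refl
lookup-injective (x∉xs ∷ _)      zero    (suc j) eq = contradiction eq (All.lookup x∉xs (∈-lookup j))
lookup-injective (x∉xs ∷ _)      (suc i) zero    eq = contradiction (sym eq) (All.lookup x∉xs (∈-lookup i))
lookup-injective (_    ∷ unique) (suc i) (suc j) eq = cong suc (lookup-injective unique i j eq)

-- Normalised to even weight, the vertices of a clique of G_ℓ form an equidistant code: the
-- distance of two of them is even (both weights are) and lies in {ℓ, ℓ + 1} (adjacency).
clique-equidistant : ∀ ℓ (K : List (Vertex ℓ)) → IsClique ℓ K → ∀ i j → i ≢ j →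
  hamming (normalise (List.lookup K i)) (normalise (List.lookup K j)) ≡ evenNeighbour ℓ
clique-equidistant ℓ K (unique , adjacent) i j i≢j = even-choice ℓ even-distance normalised-adjacent
  where
  x = List.lookup K i
  y = List.lookup K j
  normalised-adjacent : Adj ℓ (normalise x) (normalise y)
  normalised-adjacent = Adj-normalise x y (adjacent x y (∈-lookup i) (∈-lookup j) (i≢j ∘ lookup-injective unique i j))
  even-distance : odd (hamming (normalise x) (normalise y)) ≡ false
  even-distance = trans (odd-hamming (normalise x) (normalise y)) (cong₂ _xor_ (parity-normalise ℓ x) (parity-normalise ℓ y))

proposition3p10 : (ℓ : ℕ) → 2 ≤ ℓ → (K : List (Vertex ℓ)) →
    IsClique ℓ K → length K ≤ 2 * ℓ + 2
proposition3p10 ℓ 2≤ℓ K clique = subst (length K ≤_) (+-comm 2 (2 * ℓ)) code-bound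
  where
  code-bound : length K ≤ suc (suc (2 * ℓ))
  code-bound = equidistant-code-bound (evenNeighbour ℓ)
    (evenNeighbour≢0 ℓ (≤-trans (s≤s z≤n) 2≤ℓ)) (evenNeighbour-doubled ℓ)
    (normalise ∘ List.lookup K) (clique-equidistant ℓ K clique)
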